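{- Consider a partial packing of the three bins $A,B,C$ (all current loads at most $22$) such that $s(A)\ge 15$ and either (i) $s(B)+s(C)\ge 22$, or (ii) $s(C)<4$ and $s(B)$ is arbitrary. Then there exists an online algorithm that, continuing from this partial packing, packs all remaining items of the input sequence into the three bins so that every bin has load at most $22$.
   Context: Scaled setting of Online Bin Stretching with three bins: items with sizes in $[0,16]$ arrive online one by one and each must be packed immediately and irrevocably into one of three bins $A,B,C$; it is guaranteed that the whole input sequence (items already packed together with all future items) can be packed offline into three bins of capacity $16$. A partial packing is an assignment of each item of some prefix of the input sequence (the items arrived so far) to one of the bins $A,B,C$. For a bin $X$, $s(X)$ denotes the total size of items currently assigned to $X$. The online algorithm must handle every possible continuation of the input satisfying the guarantee.
   Formalization: Item sizes, of the items already packed and of all future items, are rational numbers in $[0,16]$. -}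

module Defs where

open import Data.Bool using (Bool; true; false; if_then_else_)
open import Data.Integer using (+_)
open import Data.List using (List; []; _∷_; _++_; [_]; map)
open import Data.Product using (_×_; _,_; ∃; proj₁)
open import Data.Rational using (ℚ; 0ℚ; _+_; _≤_; _/_)
open import Relation.Binary.PropositionalEquality using (_≡_)

data Bin : Set where
  A B C : Bin

sameBin : Bin → Bin → Bool
sameBin A A = true
sameBin B B = true
sameBin C C = true
sameBin _ _ = false

-- Rational constant n (scaled setting: capacity 16, stretched capacity 22).
q : (n : Data.Integer.ℤ) → ℚ
q n = n / 1

-- A (partial) packing: the items arrived so far, in arrival order,
-- each with the bin it was assigned to.
Packing : Set
Packing = List (ℚ × Bin)

load : Packing → Bin → ℚ
load [] X = 0ℚ
load ((x , Y) ∷ p) X = if sameBin X Y then x + load p X else load p X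

items : Packing → List ℚ
items = map proj₁

ValidItem : ℚ → Set
ValidItem x = (0ℚ ≤ x) × (x ≤ q (+ 16))

data AllValid : List ℚ → Set where
  []  : AllValid []
  _∷_ : ∀ {x xs} → ValidItem x → AllValid xs → AllValid (x ∷ xs)

OfflineFeasible : List ℚ → Set
OfflineFeasible xs = ∃ λ (p : Packing) → (items p ≡ xs) × (∀ X → load p X ≤ q (+ 16))

-- An online algorithm: given the current partial packing (full history of
-- items and their bins) and the size of the newly arrived item, choose a bin.
-- It has no access to future items.
OnlineAlgorithm : Set
OnlineAlgorithm = Packing → ℚ → Bin

run : OnlineAlgorithm → Packing → List ℚ → Packing
run alg p [] = p
run alg p (x ∷ xs) = run alg (p ++ [ (x , alg p x) ]) xs

-- Keep the invariant: s(A) ≥ 15, the current loads plus the volume still to come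
-- total at most 48 (the offline packing fills three bins of capacity 16), and
-- s(B) + s(C) ≥ 22 or s(C) < 4. While s(B) + s(C) ≥ 22, the fuller of B, C holds
-- at least 11, so the other one has room for every remaining item: everything
-- still to come amounts to at most 48 − 15 − 11 − (its load) = 22 − (its load).
-- Otherwise s(C) < 4: an item goes into B if it fits, and else into C, where it
-- fits since 4 + 16 ≤ 22 and after which s(B) + s(C) > 22.
module Submission where

open import Defs
open import Data.Integer using (+_)
open import Data.List using (List; _++_; []; _∷_; [_]; foldr)
open import Data.Product using (∃; _,_; proj₁)
open import Data.Sum using (_⊎_; inj₁; inj₂)
open import Data.Rational using (ℚ; _+_; _≤_; _<_; 0ℚ)
open import Data.Rational.Properties
open import Data.Rational.Solver using (module +-*-Solver)
open import Data.Bool using (true; false; if_then_else_)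
open import Data.Empty using (⊥-elim)
open import Data.Unit using (tt)
open import Relation.Nullary using (yes; no)
open import Relation.Nullary.Decidable using (toWitness)
open import Relation.Binary.PropositionalEquality
  using (_≡_; refl; sym; trans; cong; subst; module ≡-Reasoning)

volume : List ℚ → ℚ
volume = foldr _+_ 0ℚ

volume-++ : ∀ xs ys → volume (xs ++ ys) ≡ volume xs + volume ys
volume-++ [] ys = sym (+-identityˡ _)
volume-++ (x ∷ xs) ys = trans (cong (λ t → x + t) (volume-++ xs ys)) (sym (+-assoc x _ _))

volume-nonneg : ∀ {xs} → AllValid xs → 0ℚ ≤ volume xs
volume-nonneg [] = ≤-refl
volume-nonneg (v ∷ vs) = +-mono-≤ (proj₁ v) (volume-nonneg vs)

load-nonneg : ∀ p → AllValid (items p) → ∀ X → 0ℚ ≤ load p X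
load-nonneg [] _ X = ≤-refl
load-nonneg ((x , Y) ∷ p) (v ∷ vs) X with sameBin X Y
... | true  = +-mono-≤ (proj₁ v) (load-nonneg p vs X)
... | false = load-nonneg p vs X

load-snoc : ∀ p x Y X →
  load (p ++ [ (x , Y) ]) X ≡ load p X + (if sameBin X Y then x else 0ℚ)
load-snoc [] x Y X with sameBin X Y
... | true  = trans (+-identityʳ x) (sym (+-identityˡ x))
... | false = refl
load-snoc ((y , Z) ∷ p) x Y X with sameBin X Z
... | true  = trans (cong (λ t → y + t) (load-snoc p x Y X)) (sym (+-assoc y _ _))
... | false = load-snoc p x Y X

load-snoc-hit : ∀ p x X → load (p ++ [ (x , X) ]) X ≡ load p X + x
load-snoc-hit p x A = load-snoc p x A A
load-snoc-hit p x B = load-snoc p x B B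
load-snoc-hit p x C = load-snoc p x C C

load-snoc-miss : ∀ p x Y X → sameBin X Y ≡ false → load (p ++ [ (x , Y) ]) X ≡ load p X
load-snoc-miss p x Y X miss = begin
  load (p ++ [ (x , Y) ]) X                    ≡⟨ load-snoc p x Y X ⟩
  load p X + (if sameBin X Y then x else 0ℚ)   ≡⟨ cong (λ b → load p X + (if b then x else 0ℚ)) miss ⟩
  load p X + 0ℚ                                ≡⟨ +-identityʳ _ ⟩
  load p X                                     ∎
  where open ≡-Reasoning

module Rearrange where
  open +-*-Solver

  items-into-A : ∀ x a b c → x + (a + b + c) ≡ (x + a) + b + c
  items-into-A = solve 4 (λ x a b c → x :+ (a :+ b :+ c) := (x :+ a) :+ b :+ c) refl

  items-into-B : ∀ x a b c → x + (a + b + c) ≡ a + (x + b) + c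
  items-into-B = solve 4 (λ x a b c → x :+ (a :+ b :+ c) := a :+ (x :+ b) :+ c) refl

  items-into-C : ∀ x a b c → x + (a + b + c) ≡ a + b + (x + c)
  items-into-C = solve 4 (λ x a b c → x :+ (a :+ b :+ c) := a :+ b :+ (x :+ c)) refl

  next-into-B : ∀ a b c x s → a + b + c + (x + s) ≡ a + (b + x) + c + s
  next-into-B = solve 5 (λ a b c x s → a :+ b :+ c :+ (x :+ s) := a :+ (b :+ x) :+ c :+ s) refl

  next-into-C : ∀ a b c x s → a + b + c + (x + s) ≡ a + b + (c + x) + s
  next-into-C = solve 5 (λ a b c x s → a :+ b :+ c :+ (x :+ s) := a :+ b :+ (c :+ x) :+ s) refl

  smaller-B-last : ∀ a b c x → a + b + c + x ≡ (a + c) + (b + x)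
  smaller-B-last = solve 4 (λ a b c x → a :+ b :+ c :+ x := (a :+ c) :+ (b :+ x)) refl

  smaller-C-last : ∀ a b c x → a + b + c + x ≡ (a + b) + (c + x)
  smaller-C-last = solve 4 (λ a b c x → a :+ b :+ c :+ x := (a :+ b) :+ (c :+ x)) refl

  swap-last : ∀ b c x → b + c + x ≡ b + x + c
  swap-last = solve 3 (λ b c x → b :+ c :+ x := b :+ x :+ c) refl

volume-items : ∀ p → volume (items p) ≡ load p A + load p B + load p C
volume-items [] = refl
volume-items ((x , A) ∷ p) =
  trans (cong (λ t → x + t) (volume-items p)) (Rearrange.items-into-A x (load p A) (load p B) (load p C))
volume-items ((x , B) ∷ p) =
  trans (cong (λ t → x + t) (volume-items p)) (Rearrange.items-into-B x (load p A) (load p B) (load p C))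
volume-items ((x , C) ∷ p) =
  trans (cong (λ t → x + t) (volume-items p)) (Rearrange.items-into-C x (load p A) (load p B) (load p C))

OfflineFeasible⇒volume≤48 : ∀ xs → OfflineFeasible xs → volume xs ≤ q (+ 48)
OfflineFeasible⇒volume≤48 xs (p , items≡xs , fits) =
  subst (_≤ q (+ 48)) (trans (sym (volume-items p)) (cong volume items≡xs))
    (+-mono-≤ (+-mono-≤ (fits A) (fits B)) (fits C))

≤-+-nonneg : ∀ u {v} → 0ℚ ≤ v → u ≤ u + v
≤-+-nonneg u {v} 0≤v = subst (_≤ u + v) (+-identityʳ u) (+-monoʳ-≤ u 0≤v)

larger-half : ∀ {u v} → q (+ 22) ≤ u + v → u ≤ v → q (+ 11) ≤ v
larger-half {u} {v} 22≤u+v u≤v = ≮⇒≥ λ v<11 →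
  <-irrefl refl (<-≤-trans (≤-<-trans (+-monoˡ-≤ v u≤v) (+-mono-< v<11 v<11)) 22≤u+v)

smaller-bin-fits : ∀ {a u v x} → q (+ 15) ≤ a → q (+ 22) ≤ u + v → u ≤ v
  → (a + v) + (u + x) ≤ q (+ 48) → u + x ≤ q (+ 22)
smaller-bin-fits 15≤a 22≤u+v u≤v total = ≮⇒≥ λ 22<u+x →
  <-irrefl refl (<-≤-trans (+-mono-≤-< (+-mono-≤ 15≤a (larger-half 22≤u+v u≤v)) 22<u+x) total)

-- `rest` is the total size of the items still to arrive.
record Safe (a b c rest : ℚ) : Set where
  field
    fitsA  : a ≤ q (+ 22)
    fitsB  : b ≤ q (+ 22)
    fitsC  : c ≤ q (+ 22)
    0≤c    : 0ℚ ≤ c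
    15≤a   : q (+ 15) ≤ a
    volume≤48 : a + b + c + rest ≤ q (+ 48)
    balanced⊎smallC : (q (+ 22) ≤ b + c) ⊎ (c < q (+ 4))

module _ {a b c x s : ℚ} (S : Safe a b c (x + s)) (0≤x : 0ℚ ≤ x) where
  open Safe S

  balanced-put-B : 0ℚ ≤ s → q (+ 22) ≤ b + c → b ≤ c → Safe a (b + x) c s
  balanced-put-B 0≤s 22≤b+c b≤c = record
    { fitsA = fitsA ; fitsB = smaller-bin-fits 15≤a 22≤b+c b≤c sizes ; fitsC = fitsC
    ; 0≤c = 0≤c ; 15≤a = 15≤a
    ; volume≤48 = subst (_≤ q (+ 48)) (Rearrange.next-into-B a b c x s) volume≤48
    ; balanced⊎smallC = inj₁ (≤-trans 22≤b+c
        (subst (b + c ≤_) (Rearrange.swap-last b c x) (≤-+-nonneg (b + c) 0≤x))) }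
    where
    sizes : (a + c) + (b + x) ≤ q (+ 48)
    sizes = subst (_≤ q (+ 48)) (Rearrange.smaller-B-last a b c x)
      (≤-trans (+-monoʳ-≤ (a + b + c) (≤-+-nonneg x 0≤s)) volume≤48)

  balanced-put-C : 0ℚ ≤ s → q (+ 22) ≤ b + c → c ≤ b → Safe a b (c + x) s
  balanced-put-C 0≤s 22≤b+c c≤b = record
    { fitsA = fitsA ; fitsB = fitsB
    ; fitsC = smaller-bin-fits 15≤a (subst (q (+ 22) ≤_) (+-comm b c) 22≤b+c) c≤b sizes
    ; 0≤c = +-mono-≤ 0≤c 0≤x ; 15≤a = 15≤a
    ; volume≤48 = subst (_≤ q (+ 48)) (Rearrange.next-into-C a b c x s) volume≤48
    ; balanced⊎smallC = inj₁ (≤-trans 22≤b+c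
        (subst (b + c ≤_) (+-assoc b c x) (≤-+-nonneg (b + c) 0≤x))) }
    where
    sizes : (a + b) + (c + x) ≤ q (+ 48)
    sizes = subst (_≤ q (+ 48)) (Rearrange.smaller-C-last a b c x)
      (≤-trans (+-monoʳ-≤ (a + b + c) (≤-+-nonneg x 0≤s)) volume≤48)

  unbalanced⇒smallC : b + c < q (+ 22) → c < q (+ 4)
  unbalanced⇒smallC b+c<22 with balanced⊎smallC
  ... | inj₁ 22≤b+c = ⊥-elim (<-irrefl refl (<-≤-trans b+c<22 22≤b+c))
  ... | inj₂ c<4    = c<4

  unbalanced-put-B : b + c < q (+ 22) → b + x ≤ q (+ 22) → Safe a (b + x) c s
  unbalanced-put-B b+c<22 b+x≤22 = record
    { fitsA = fitsA ; fitsB = b+x≤22 ; fitsC = fitsC ; 0≤c = 0≤c ; 15≤a = 15≤a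
    ; volume≤48 = subst (_≤ q (+ 48)) (Rearrange.next-into-B a b c x s) volume≤48
    ; balanced⊎smallC = inj₂ (unbalanced⇒smallC b+c<22) }

  unbalanced-put-C : x ≤ q (+ 16) → b + c < q (+ 22) → q (+ 22) < b + x → Safe a b (c + x) s
  unbalanced-put-C x≤16 b+c<22 22<b+x = record
    { fitsA = fitsA ; fitsB = fitsB
    ; fitsC = <⇒≤ (<-≤-trans (+-mono-<-≤ (unbalanced⇒smallC b+c<22) x≤16) 20≤22)
    ; 0≤c = +-mono-≤ 0≤c 0≤x ; 15≤a = 15≤a
    ; volume≤48 = subst (_≤ q (+ 48)) (Rearrange.next-into-C a b c x s) volume≤48
    ; balanced⊎smallC = inj₁ (≤-trans (<⇒≤ 22<b+x)
        (subst (b + x ≤_) (trans (sym (Rearrange.swap-last b c x)) (+-assoc b c x)) (≤-+-nonneg (b + x) 0≤c))) }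
    where
    20≤22 : q (+ 4) + q (+ 16) ≤ q (+ 22)
    20≤22 = toWitness {a? = q (+ 4) + q (+ 16) ≤? q (+ 22)} tt

place : (b c x : ℚ) → Bin
place b c x with q (+ 22) ≤? b + c | b ≤? c | b + x ≤? q (+ 22)
... | yes _ | yes _ | _     = B
... | yes _ | no _  | _     = C
... | no _  | _     | yes _ = B
... | no _  | _     | no _  = C

algorithm : OnlineAlgorithm
algorithm p x = place (load p B) (load p C) x

SafePacking : Packing → ℚ → Set
SafePacking p rest = Safe (load p A) (load p B) (load p C) rest

put-B : ∀ p x {s} → Safe (load p A) (load p B + x) (load p C) s → SafePacking (p ++ [ (x , B) ]) s
put-B p x S rewrite load-snoc-miss p x B A refl | load-snoc-hit p x B | load-snoc-miss p x B C refl = S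

put-C : ∀ p x {s} → Safe (load p A) (load p B) (load p C + x) s → SafePacking (p ++ [ (x , C) ]) s
put-C p x S rewrite load-snoc-miss p x C A refl | load-snoc-miss p x C B refl | load-snoc-hit p x C = S

algorithm-step : ∀ p x {s} → ValidItem x → 0ℚ ≤ s
  → SafePacking p (x + s) → SafePacking (p ++ [ (x , algorithm p x) ]) s
algorithm-step p x (0≤x , x≤16) 0≤s S
  with q (+ 22) ≤? load p B + load p C | load p B ≤? load p C | load p B + x ≤? q (+ 22)
... | yes bal | yes b≤c | _        = put-B p x (balanced-put-B S 0≤x 0≤s bal b≤c)
... | yes bal | no b≰c  | _        = put-C p x (balanced-put-C S 0≤x 0≤s bal (<⇒≤ (≰⇒> b≰c)))
... | no unbal | _      | yes fits = put-B p x (unbalanced-put-B S 0≤x (≰⇒> unbal) fits)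
... | no unbal | _      | no over  = put-C p x (unbalanced-put-C S 0≤x x≤16 (≰⇒> unbal) (≰⇒> over))

algorithm-safe : ∀ rest p → AllValid rest → SafePacking p (volume rest)
  → ∀ X → load (run algorithm p rest) X ≤ q (+ 22)
algorithm-safe [] p _ S A = Safe.fitsA S
algorithm-safe [] p _ S B = Safe.fitsB S
algorithm-safe [] p _ S C = Safe.fitsC S
algorithm-safe (x ∷ rest) p (v ∷ vs) S =
  algorithm-safe rest (p ++ [ (x , algorithm p x) ]) vs (algorithm-step p x v (volume-nonneg vs) S)

mainTheorem6 : (p : Packing) → AllValid (items p)
    → (∀ X → load p X ≤ q (+ 22))
    → q (+ 15) ≤ load p A
    → (q (+ 22) ≤ load p B + load p C) ⊎ (load p C < q (+ 4))
    → ∃ λ (alg : OnlineAlgorithm) → (rest : List ℚ) → AllValid rest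
    → OfflineFeasible (items p ++ rest)
    → ∀ X → load (run alg p rest) X ≤ q (+ 22)
mainTheorem6 p valid fits 15≤A bal⊎smallC = algorithm , λ rest validRest offline →
  algorithm-safe rest p validRest record
    { fitsA = fits A ; fitsB = fits B ; fitsC = fits C
    ; 0≤c = load-nonneg p valid C ; 15≤a = 15≤A
    ; volume≤48 = subst (_≤ q (+ 48))
        (trans (volume-++ (items p) rest) (cong (_+ volume rest) (volume-items p)))
        (OfflineFeasible⇒volume≤48 _ offline)
    ; balanced⊎smallC = bal⊎smallC }
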